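{- Let $\mathcal{H}=\{SS,\ AAAA,\ ASASA,\ AASAASAA,\ AAASAAASAAA\}$. The maximum length of an $\mathcal{H}$-free word over the alphabet $\{S,A\}$ is $19$; that is, there exists an $\mathcal{H}$-free word of length $19$, and every word over $\{S,A\}$ of length at least $20$ has a subword belonging to $\mathcal{H}$.
   Context: A subword of a word is any sequence of consecutive letters of it. A word is $\mathcal{H}$-free if none of its subwords belongs to $\mathcal{H}$. -}

module Defs where

open import Data.List using (List; []; _∷_; _++_; length)
open import Data.Product using (∃; ∃-syntax; _×_)
open import Relation.Binary.PropositionalEquality using (_≡_)
open import Relation.Nullary using (¬_)

data Letter : Set where
  S A : Letter

Word : Set
Word = List Letter

_IsSubwordOf_ : Word → Word → Set
u IsSubwordOf w = ∃[ p ] ∃[ q ] (p ++ u ++ q ≡ w)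

data H : Word → Set where
  h1 : H (S ∷ S ∷ [])
  h2 : H (A ∷ A ∷ A ∷ A ∷ [])
  h3 : H (A ∷ S ∷ A ∷ S ∷ A ∷ [])
  h4 : H (A ∷ A ∷ S ∷ A ∷ A ∷ S ∷ A ∷ A ∷ [])
  h5 : H (A ∷ A ∷ A ∷ S ∷ A ∷ A ∷ A ∷ S ∷ A ∷ A ∷ A ∷ [])

HasHSubword : Word → Set
HasHSubword w = ∃[ u ] (H u × u IsSubwordOf w)

HFree : Word → Set
HFree w = ¬ HasHSubword w

{-# OPTIONS --safe #-}
-- Subword occurrence is decidable, so H-freeness of a fixed word is checked by evaluation.
-- For the bound, "every extension of s by at least n letters has an H-subword" holds iff
-- s already has one, or n > 0 and it holds for n - 1 at both one-letter extensions of s.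
-- This is a decision procedure whose search tree, cut off at the first forbidden subword,
-- is small enough to evaluate from the empty word with n = 20.
module Submission where

open import Defs
open import Data.List using (List; []; _∷_; _++_; _∷ʳ_; length)
open import Data.List.Properties using (++-assoc; ++-identityʳ)
open import Data.List.Membership.Propositional using (_∈_; find; lose)
open import Data.List.Relation.Unary.Any using (Any; here; there; any?)
open import Data.List.Relation.Binary.Pointwise using (Pointwise-≡⇒≡; ≡⇒Pointwise-≡)
open import Data.List.Relation.Binary.Infix.Heterogeneous using (Infix; MkView; toView; fromView)
open import Data.List.Relation.Binary.Infix.Heterogeneous.Properties using (infix?)
open import Data.Nat using (ℕ; zero; suc; _≥_; z≤n; s≤s)
open import Data.Product using (∃-syntax; _×_; _,_; uncurry)
open import Data.Sum using (inj₂; [_,_])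
open import Relation.Binary.Definitions using (DecidableEquality)
open import Relation.Binary.PropositionalEquality using (_≡_; refl; sym; trans; cong; subst)
open import Relation.Nullary.Decidable using (Dec; yes; no; map′; _×-dec_; _⊎-dec_; toWitness; toWitnessFalse)

_≟ₗ_ : DecidableEquality Letter
S ≟ₗ S = yes refl
S ≟ₗ A = no λ ()
A ≟ₗ S = no λ ()
A ≟ₗ A = yes refl

infix⇒subword : ∀ {u w} → Infix _≡_ u w → u IsSubwordOf w
infix⇒subword i with MkView p pw q ← toView i = p , q , cong (λ v → p ++ v ++ q) (Pointwise-≡⇒≡ pw)

subword⇒infix : ∀ {u w} → u IsSubwordOf w → Infix _≡_ u w
subword⇒infix (p , q , refl) = fromView (MkView p (≡⇒Pointwise-≡ refl) q)

_isSubwordOf?_ : ∀ u w → Dec (u IsSubwordOf w)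
u isSubwordOf? w = map′ infix⇒subword subword⇒infix (infix? _≟ₗ_ u w)

forbidden : List Word
forbidden = (S ∷ S ∷ [])
          ∷ (A ∷ A ∷ A ∷ A ∷ [])
          ∷ (A ∷ S ∷ A ∷ S ∷ A ∷ [])
          ∷ (A ∷ A ∷ S ∷ A ∷ A ∷ S ∷ A ∷ A ∷ [])
          ∷ (A ∷ A ∷ A ∷ S ∷ A ∷ A ∷ A ∷ S ∷ A ∷ A ∷ A ∷ [])
          ∷ []

H⇒∈forbidden : ∀ {u} → H u → u ∈ forbidden
H⇒∈forbidden h1 = here refl
H⇒∈forbidden h2 = there (here refl)
H⇒∈forbidden h3 = there (there (here refl))
H⇒∈forbidden h4 = there (there (there (here refl)))
H⇒∈forbidden h5 = there (there (there (there (here refl))))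

∈forbidden⇒H : ∀ {u} → u ∈ forbidden → H u
∈forbidden⇒H (here refl) = h1
∈forbidden⇒H (there (here refl)) = h2
∈forbidden⇒H (there (there (here refl))) = h3
∈forbidden⇒H (there (there (there (here refl)))) = h4
∈forbidden⇒H (there (there (there (there (here refl))))) = h5

hasHSubword? : ∀ w → Dec (HasHSubword w)
hasHSubword? w = map′ fromAny toAny (any? (_isSubwordOf? w) forbidden)
  where
  fromAny : Any (_IsSubwordOf w) forbidden → HasHSubword w
  fromAny occ with u , u∈ , sub ← find occ = u , ∈forbidden⇒H u∈ , sub

  toAny : HasHSubword w → Any (_IsSubwordOf w) forbidden
  toAny (u , hu , sub) = lose (H⇒∈forbidden hu) sub

HasHSubword-++ʳ : ∀ {s} u → HasHSubword s → HasHSubword (s ++ u)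
HasHSubword-++ʳ u (h , hh , p , q , refl) =
  h , hh , p , q ++ u , sym (trans (++-assoc p (h ++ q) u) (cong (p ++_) (++-assoc h q u)))

Unavoidable : ℕ → Word → Set
Unavoidable n s = ∀ u → length u ≥ n → HasHSubword (s ++ u)

Unavoidable-zero⇒HasHSubword : ∀ {s} → Unavoidable 0 s → HasHSubword s
Unavoidable-zero⇒HasHSubword {s} unav = subst HasHSubword (++-identityʳ s) (unav [] z≤n)

HasHSubword⇒Unavoidable : ∀ {s} n → HasHSubword s → Unavoidable n s
HasHSubword⇒Unavoidable n occ u _ = HasHSubword-++ʳ u occ

Unavoidable-∷ʳ : ∀ {n s} → Unavoidable (suc n) s → ∀ x → Unavoidable n (s ∷ʳ x)
Unavoidable-∷ʳ {s = s} unav x u len =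
  subst HasHSubword (sym (++-assoc s (x ∷ []) u)) (unav (x ∷ u) (s≤s len))

Unavoidable-branch : ∀ {n s} → Unavoidable n (s ∷ʳ S) → Unavoidable n (s ∷ʳ A) → Unavoidable (suc n) s
Unavoidable-branch {s = s} unavS unavA (S ∷ u) (s≤s len) = subst HasHSubword (++-assoc s (S ∷ []) u) (unavS u len)
Unavoidable-branch {s = s} unavS unavA (A ∷ u) (s≤s len) = subst HasHSubword (++-assoc s (A ∷ []) u) (unavA u len)

unavoidable? : ∀ n s → Dec (Unavoidable n s)
unavoidable? zero s = map′ (HasHSubword⇒Unavoidable 0) Unavoidable-zero⇒HasHSubword (hasHSubword? s)
unavoidable? (suc n) s =
  map′ [ HasHSubword⇒Unavoidable (suc n) , uncurry Unavoidable-branch ]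
       (λ unav → inj₂ (Unavoidable-∷ʳ unav S , Unavoidable-∷ʳ unav A))
       (hasHSubword? s ⊎-dec (unavoidable? n (s ∷ʳ S) ×-dec unavoidable? n (s ∷ʳ A)))

longestHFreeWord : Word
longestHFreeWord = S ∷ A ∷ S ∷ A ∷ A ∷ S ∷ A ∷ A ∷ A ∷ S ∷ A ∷ A ∷ A ∷ S ∷ A ∷ A ∷ S ∷ A ∷ S ∷ []

lemma10 : (∃[ w ] (length w ≡ 19 × HFree w))
            × (∀ w → length w ≥ 20 → HasHSubword w)
lemma10 = (longestHFreeWord , refl , toWitnessFalse {a? = hasHSubword? longestHFreeWord} _)
        , toWitness {a? = unavoidable? 20 []} _
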